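{- Let $\mathcal{G}\subseteq\mathbb{R}^n$ be a sub-module of the $\mathbb{Z}$-module $\mathbb{R}^n$, $\mathcal{S}\subseteq\mathcal{G}$ finite, $X\subseteq\mathcal{S}$ and $\overline X=\mathcal{S}\setminus X$, and let $\mathcal{C}=\{(\vec v_i,w_i)\}_{i\in\mathcal{I}}$ be a chamfer mask with weighted distance $d=d_{\mathcal{C}}$. Let $p\in X$ and $q\in\overline X$ satisfy $d(p,q)=d(p,\overline X)$, and let $\alpha_i\in\mathbb{Z}$, $\alpha_i\ge0$ ($i\in\mathcal{I}$), be such that $p=q+\sum_{i\in\mathcal{I}}\alpha_i\vec v_i$ and $d(p,q)=\sum_{i\in\mathcal{I}}\alpha_iw_i$ (such coefficients exist). Then for any integers $\beta_i$ with $0\le\beta_i\le\alpha_i$ ($i\in\mathcal{I}$), if $p'=q+\sum_{i\in\mathcal{I}}\beta_i\vec v_i\in\mathcal{S}$, then $d(p',\overline X)=d(p',q)=\sum_{i\in\mathcal{I}}\beta_iw_i$.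
   Context: A sub-module of the $\mathbb{Z}$-module $\mathbb{R}^n$ is an additive subgroup of $\mathbb{R}^n$. A chamfer mask is a finite set $\mathcal{C}=\{(\vec v_i,w_i)\}_{i\in\mathcal{I}}\subseteq\mathcal{G}\times\mathbb{Z}$ containing a basis of the $\mathbb{Z}$-module $\mathcal{G}$ among its vectors, with $w_i>0$ and $\vec v_i\ne0$, and symmetric ($(\vec v,w)\in\mathcal{C}\Rightarrow(-\vec v,w)\in\mathcal{C}$). A path from $x$ to $y$ is given by integers $\gamma_i\ge0$ with $\sum_i\gamma_i\vec v_i=y-x$, of cost $\sum_i\gamma_iw_i$; $d_{\mathcal{C}}(x,y)$ is the minimum cost of such paths (paths are not restricted to $\mathcal{S}$). For $x\in\mathcal{S}$, $d(x,\overline X)=\min_{y\in\overline X}d(x,y)$. -}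

module Defs where

open import Data.Nat as ℕ using (ℕ; zero; suc)
open import Data.Integer as ℤ using (ℤ; +_)
open import Data.Fin using (Fin; zero; suc)
open import Data.Vec using (Vec; zipWith; map; replicate)
open import Data.List using (List)
open import Data.List.Membership.Propositional using (_∈_)
open import Data.Product using (Σ; _×_; ∃)
open import Relation.Binary.PropositionalEquality using (_≡_; _≢_)
open import Relation.Nullary using (¬_)

-- The module G (free of finite rank m, as it contains a basis) is modelled as ℤ^m.
G : ℕ → Set
G m = Vec ℤ m

_⊕_ : ∀ {m} → G m → G m → G m
_⊕_ = zipWith ℤ._+_

⊖_ : ∀ {m} → G m → G m
⊖_ = map (λ a → ℤ.- a)

_⊝_ : ∀ {m} → G m → G m → G m
x ⊝ y = x ⊕ (⊖ y)

𝟘 : ∀ {m} → G m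
𝟘 = replicate _ (+ 0)

_·_ : ∀ {m} → ℤ → G m → G m
c · x = map (c ℤ.*_) x

ΣG : ∀ {m k} → (Fin k → G m) → G m
ΣG {k = zero} f = 𝟘
ΣG {k = suc k} f = f zero ⊕ ΣG (λ i → f (suc i))

Σℕ : ∀ {k} → (Fin k → ℕ) → ℕ
Σℕ {zero} f = 0
Σℕ {suc k} f = f zero ℕ.+ Σℕ (λ i → f (suc i))

record ChamferMask (m k : ℕ) : Set where
  field
    v : Fin k → G m
    w : Fin k → ℕ
    w-pos : ∀ i → 0 ℕ.< w i
    v-nonzero : ∀ i → v i ≢ 𝟘
    symmetric : ∀ i → ∃ λ j → v j ≡ ⊖ (v i) × w j ≡ w i
    basis : Σ (Fin m → Fin k) λ e →
              (∀ (x : G m) → ∃ λ (c : Fin m → ℤ) → x ≡ ΣG (λ j → c j · v (e j)))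
            × (∀ (c : Fin m → ℤ) → ΣG (λ j → c j · v (e j)) ≡ 𝟘 → ∀ j → c j ≡ + 0)

module _ {m k : ℕ} (C : ChamferMask m k) where
  open ChamferMask C

  comb : (Fin k → ℕ) → G m
  comb γ = ΣG (λ i → (+ γ i) · v i)

  cost : (Fin k → ℕ) → ℕ
  cost γ = Σℕ (λ i → γ i ℕ.* w i)

  IsPath : G m → G m → (Fin k → ℕ) → Set
  IsPath x y γ = comb γ ≡ y ⊝ x

  IsDist : G m → G m → ℕ → Set
  IsDist x y c = (∃ λ γ → IsPath x y γ × cost γ ≡ c)
               × (∀ γ → IsPath x y γ → c ℕ.≤ cost γ)

  InXbar : List (G m) → (G m → Set) → G m → Set
  InXbar S X y = y ∈ S × ¬ X y

  IsDistToXbar : List (G m) → (G m → Set) → G m → ℕ → Set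
  IsDistToXbar S X x c = (∃ λ y → InXbar S X y × IsDist x y c)
                       × (∀ y c' → InXbar S X y → IsDist x y c' → c ℕ.≤ c')

-- Split the optimal path α from p back to q as α = β + δ, so that p' = q + Σ β v and p = p' + Σ δ v.
-- By symmetry of the mask, p' is reached from p at cost Σ δ w and q from p' at cost Σ β w.
-- A path from p' to some y ∈ X̄ of cost c then yields a path from p to y of cost Σ δ w + c, which
-- cannot be cheaper than d(p , X̄) = Σ β w + Σ δ w; hence c ≥ Σ β w, and q attains this bound.
module Submission where

open import Defs
open import Data.Nat using (ℕ; _≤_)
open import Data.Fin using (Fin)
open import Data.List using (List)
open import Data.List.Membership.Propositional using (_∈_)
open import Data.Product using (_×_)
open import Relation.Binary.PropositionalEquality using (_≡_)

open import Algebra.Bundles using (AbelianGroup)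
open import Algebra.Structures using (IsAbelianGroup)
open import Data.Empty using (⊥-elim)
open import Data.Fin using (zero; suc)
open import Data.Integer as ℤ using (ℤ; +_)
import Data.Integer.Properties as ℤP
open import Data.Nat as ℕ using (zero; suc; _<_; _∸_; _≤?_)
import Data.Nat.Properties as ℕP
open import Algebra.Properties.CommutativeSemigroup ℕP.+-commutativeSemigroup
  using () renaming (interchange to +-interchange)
open import Data.Nat.Induction using (<-wellFounded)
open import Data.Product using (∃; _,_; proj₁)
open import Data.Vec using ([]; _∷_)
open import Data.Vec.Properties
  using (zipWith-assoc; zipWith-identityˡ; zipWith-identityʳ; zipWith-inverseˡ; zipWith-inverseʳ; zipWith-comm)
open import Induction.WellFounded using (Acc; acc)
open import Level using (0ℓ)
open import Relation.Nullary using (yes; no)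
open import Relation.Binary.PropositionalEquality
  using (refl; sym; trans; cong; cong₂; subst; subst₂; isEquivalence; module ≡-Reasoning)

⊕-isAbelianGroup : ∀ m → IsAbelianGroup (_≡_ {A = G m}) _⊕_ 𝟘 ⊖_
⊕-isAbelianGroup m = record
  { isGroup = record
    { isMonoid = record
      { isSemigroup = record
        { isMagma = record { isEquivalence = isEquivalence ; ∙-cong = cong₂ _⊕_ }
        ; assoc = zipWith-assoc ℤP.+-assoc
        }
      ; identity = zipWith-identityˡ ℤP.+-identityˡ , zipWith-identityʳ ℤP.+-identityʳ
      }
    ; inverse = zipWith-inverseˡ ℤP.+-inverseˡ , zipWith-inverseʳ ℤP.+-inverseʳ
    ; ⁻¹-cong = cong ⊖_
    }
  ; comm = zipWith-comm ℤP.+-comm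
  }

⊕-abelianGroup : ℕ → AbelianGroup 0ℓ 0ℓ
⊕-abelianGroup m = record { isAbelianGroup = ⊕-isAbelianGroup m }

·-zeroˡ : ∀ {m} (x : G m) → (+ 0) · x ≡ 𝟘
·-zeroˡ [] = refl
·-zeroˡ (a ∷ x) = cong₂ _∷_ (ℤP.*-zeroˡ a) (·-zeroˡ x)

·-distribʳ-+ : ∀ {m} (a b : ℤ) (x : G m) → (a ℤ.+ b) · x ≡ (a · x) ⊕ (b · x)
·-distribʳ-+ a b [] = refl
·-distribʳ-+ a b (c ∷ x) = cong₂ _∷_ (ℤP.*-distribʳ-+ c a b) (·-distribʳ-+ a b x)

·-⊖ : ∀ {m} (a : ℤ) (x : G m) → a · (⊖ x) ≡ ⊖ (a · x)
·-⊖ a [] = refl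
·-⊖ a (c ∷ x) = cong₂ _∷_ (sym (ℤP.neg-distribʳ-* a c)) (·-⊖ a x)

single : ∀ {k} → Fin k → ℕ → Fin k → ℕ
single zero    n zero    = n
single zero    n (suc i) = 0
single (suc j) n zero    = 0
single (suc j) n (suc i) = single j n i

module _ {m : ℕ} where
  open AbelianGroup (⊕-abelianGroup m)
    using (assoc; comm; identityˡ; identityʳ; inverseˡ; inverseʳ; commutativeSemigroup)
  open import Algebra.Properties.AbelianGroup (⊕-abelianGroup m) using (ε⁻¹≈ε; ⁻¹-∙-comm)
  open import Algebra.Properties.CommutativeSemigroup commutativeSemigroup using (interchange)
  open ≡-Reasoning

  ⊝-trans : ∀ (x y z : G m) → (y ⊝ x) ⊕ (z ⊝ y) ≡ z ⊝ x
  ⊝-trans x y z = begin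
    (y ⊝ x) ⊕ (z ⊝ y)       ≡⟨ comm (y ⊝ x) (z ⊝ y) ⟩
    (z ⊝ y) ⊕ (y ⊝ x)       ≡⟨ assoc z (⊖ y) (y ⊝ x) ⟩
    z ⊕ ((⊖ y) ⊕ (y ⊝ x))   ≡⟨ cong (z ⊕_) (sym (assoc (⊖ y) y (⊖ x))) ⟩
    z ⊕ (((⊖ y) ⊕ y) ⊝ x)   ≡⟨ cong (λ e → z ⊕ (e ⊝ x)) (inverseˡ y) ⟩
    z ⊕ (𝟘 ⊝ x)             ≡⟨ cong (z ⊕_) (identityˡ (⊖ x)) ⟩
    z ⊝ x                   ∎

  ⊝-⊕-cancelˡ : ∀ (x a : G m) → x ⊝ (x ⊕ a) ≡ ⊖ a
  ⊝-⊕-cancelˡ x a = begin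
    x ⊕ (⊖ (x ⊕ a))       ≡⟨ cong (x ⊕_) (sym (⁻¹-∙-comm x a)) ⟩
    x ⊕ ((⊖ x) ⊕ (⊖ a))   ≡⟨ sym (assoc x (⊖ x) (⊖ a)) ⟩
    (x ⊝ x) ⊕ (⊖ a)       ≡⟨ cong (_⊕ (⊖ a)) (inverseʳ x) ⟩
    𝟘 ⊕ (⊖ a)             ≡⟨ identityˡ (⊖ a) ⟩
    ⊖ a                   ∎

  ΣG-cong : ∀ {k} {f g : Fin k → G m} → (∀ i → f i ≡ g i) → ΣG f ≡ ΣG g
  ΣG-cong {zero} f≗g = refl
  ΣG-cong {suc k} f≗g = cong₂ _⊕_ (f≗g zero) (ΣG-cong (λ i → f≗g (suc i)))

  ΣG-𝟘 : ∀ {k} → ΣG {m} {k} (λ _ → 𝟘) ≡ 𝟘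
  ΣG-𝟘 {zero} = refl
  ΣG-𝟘 {suc k} = trans (cong (𝟘 ⊕_) (ΣG-𝟘 {k})) (identityˡ 𝟘)

  ΣG-⊕ : ∀ {k} (f g : Fin k → G m) → ΣG (λ i → f i ⊕ g i) ≡ ΣG f ⊕ ΣG g
  ΣG-⊕ {zero} f g = sym (identityˡ 𝟘)
  ΣG-⊕ {suc k} f g = trans (cong ((f zero ⊕ g zero) ⊕_) (ΣG-⊕ (λ i → f (suc i)) (λ i → g (suc i))))
                           (interchange (f zero) (g zero) _ _)

  ΣG-⊖ : ∀ {k} (f : Fin k → G m) → ΣG (λ i → ⊖ f i) ≡ ⊖ (ΣG f)
  ΣG-⊖ {zero} f = sym ε⁻¹≈ε
  ΣG-⊖ {suc k} f = trans (cong ((⊖ f zero) ⊕_) (ΣG-⊖ (λ i → f (suc i)))) (⁻¹-∙-comm (f zero) _)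

  ΣG-single : ∀ {k} (u : Fin k → G m) (j : Fin k) (n : ℕ) → ΣG (λ i → (+ single j n i) · u i) ≡ (+ n) · u j
  ΣG-single {k = suc k} u zero n =
    trans (cong (((+ n) · u zero) ⊕_) (trans (ΣG-cong (λ i → ·-zeroˡ (u (suc i)))) (ΣG-𝟘 {k = k})))
          (identityʳ _)
  ΣG-single u (suc j) n =
    trans (cong₂ _⊕_ (·-zeroˡ (u zero)) (ΣG-single (λ i → u (suc i)) j n))
          (identityˡ _)

Σℕ-cong : ∀ {k} {f g : Fin k → ℕ} → (∀ i → f i ≡ g i) → Σℕ f ≡ Σℕ g
Σℕ-cong {zero} f≗g = refl
Σℕ-cong {suc k} f≗g = cong₂ ℕ._+_ (f≗g zero) (Σℕ-cong (λ i → f≗g (suc i)))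

Σℕ-zero : ∀ {k} → Σℕ {k} (λ _ → 0) ≡ 0
Σℕ-zero {zero} = refl
Σℕ-zero {suc k} = Σℕ-zero {k}

Σℕ-+ : ∀ {k} (f g : Fin k → ℕ) → Σℕ (λ i → f i ℕ.+ g i) ≡ Σℕ f ℕ.+ Σℕ g
Σℕ-+ {zero} f g = refl
Σℕ-+ {suc k} f g = trans (cong (f zero ℕ.+ g zero ℕ.+_) (Σℕ-+ (λ i → f (suc i)) (λ i → g (suc i))))
                         (+-interchange (f zero) (g zero) _ _)

Σℕ-single : ∀ {k} (u : Fin k → ℕ) (j : Fin k) (n : ℕ) → Σℕ (λ i → single j n i ℕ.* u i) ≡ n ℕ.* u j
Σℕ-single {suc k} u zero n = trans (cong (n ℕ.* u zero ℕ.+_) (Σℕ-zero {k})) (ℕP.+-identityʳ _)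
Σℕ-single u (suc j) n = Σℕ-single (λ i → u (suc i)) j n

-- Without decidability of P no least element need exist; instead, when b ≰ n, the induction
-- hypothesis bounds every smaller element of P by b, which makes n minimal.
minima-bounded⇒bounded : ∀ {ℓ} (P : ℕ → Set ℓ) {b : ℕ} →
  (∀ n → P n → (∀ n' → P n' → n ≤ n') → b ≤ n) → ∀ n → P n → b ≤ n
minima-bounded⇒bounded P {b} bounds-minima n = go n (<-wellFounded n)
  where
  go : ∀ n → Acc _<_ n → P n → b ≤ n
  go n (acc rec) Pn with b ≤? n
  ... | yes b≤n = b≤n
  ... | no b≰n = ⊥-elim (b≰n (bounds-minima n Pn n-minimal))
    where
    n-minimal : ∀ n' → P n' → n ≤ n'
    n-minimal n' Pn' with n ≤? n'
    ... | yes n≤n' = n≤n'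
    ... | no n≰n' = ⊥-elim (b≰n (ℕP.≤-trans (go n' (rec n'<n) Pn') (ℕP.<⇒≤ n'<n)))
      where n'<n = ℕP.≰⇒> n≰n'

module Paths {m k : ℕ} (C : ChamferMask m k) where
  open ChamferMask C

  Realizable : G m → ℕ → Set
  Realizable a c = ∃ λ γ → comb C γ ≡ a × cost C γ ≡ c

  comb-+ : ∀ γ δ → comb C (λ i → γ i ℕ.+ δ i) ≡ comb C γ ⊕ comb C δ
  comb-+ γ δ = trans (ΣG-cong (λ i → trans (cong (_· v i) (ℤP.pos-+ (γ i) (δ i)))
                                           (·-distribʳ-+ (+ γ i) (+ δ i) (v i))))
                     (ΣG-⊕ (λ i → (+ γ i) · v i) (λ i → (+ δ i) · v i))

  cost-+ : ∀ γ δ → cost C (λ i → γ i ℕ.+ δ i) ≡ cost C γ ℕ.+ cost C δ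
  cost-+ γ δ = trans (Σℕ-cong (λ i → ℕP.*-distribʳ-+ (w i) (γ i) (δ i)))
                     (Σℕ-+ (λ i → γ i ℕ.* w i) (λ i → δ i ℕ.* w i))

  realizable-𝟘 : Realizable 𝟘 0
  realizable-𝟘 = (λ _ → 0) , trans (ΣG-cong (λ i → ·-zeroˡ (v i))) (ΣG-𝟘 {k = k}) , Σℕ-zero {k}

  realizable-⊕ : ∀ {a b c d} → Realizable a c → Realizable b d → Realizable (a ⊕ b) (c ℕ.+ d)
  realizable-⊕ (γ , refl , refl) (δ , refl , refl) = (λ i → γ i ℕ.+ δ i) , comb-+ γ δ , cost-+ γ δ

  realizable-ΣG : ∀ {k'} {f : Fin k' → G m} {c : Fin k' → ℕ} →
                  (∀ i → Realizable (f i) (c i)) → Realizable (ΣG f) (Σℕ c)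
  realizable-ΣG {zero} r = realizable-𝟘
  realizable-ΣG {suc k'} r = realizable-⊕ (r zero) (realizable-ΣG (λ i → r (suc i)))

  realizable-step : ∀ j n → Realizable ((+ n) · v j) (n ℕ.* w j)
  realizable-step j n = single j n , ΣG-single v j n , Σℕ-single w j n

  -- Each step v i of γ is replaced by the opposite step of the mask, which has the same weight.
  realizable-⊖ : ∀ {a c} → Realizable a c → Realizable (⊖ a) c
  realizable-⊖ (γ , refl , refl) =
    subst (λ a → Realizable a (cost C γ))
          (trans (ΣG-cong (λ i → ·-⊖ (+ γ i) (v i))) (ΣG-⊖ (λ i → (+ γ i) · v i)))
          (realizable-ΣG reversed-step)
    where
    reversed-step : ∀ i → Realizable ((+ γ i) · (⊖ v i)) (γ i ℕ.* w i)
    reversed-step i with symmetric i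
    ... | j , vj≡⊖vi , wj≡wi = subst₂ Realizable (cong ((+ γ i) ·_) vj≡⊖vi) (cong (γ i ℕ.*_) wj≡wi)
                                      (realizable-step j (γ i))

  realizable-trans : ∀ {x y z a b} →
                     Realizable (y ⊝ x) a → Realizable (z ⊝ y) b → Realizable (z ⊝ x) (a ℕ.+ b)
  realizable-trans {x} {y} {z} r s = subst (λ e → Realizable e _) (⊝-trans x y z) (realizable-⊕ r s)

  realizable-return : ∀ x γ → Realizable (x ⊝ (x ⊕ comb C γ)) (cost C γ)
  realizable-return x γ =
    subst (λ e → Realizable e _) (sym (⊝-⊕-cancelˡ x (comb C γ))) (realizable-⊖ (γ , refl , refl))

  isDist : ∀ {x y c} → Realizable (y ⊝ x) c → (∀ c' → Realizable (y ⊝ x) c' → c ≤ c') → IsDist C x y c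
  isDist r minimal = r , λ γ γ-path → minimal _ (γ , γ-path , refl)

  dist-bounded⇒cost-bounded : ∀ {x y D} → (∀ c → IsDist C x y c → D ≤ c) →
                              ∀ c → Realizable (y ⊝ x) c → D ≤ c
  dist-bounded⇒cost-bounded {x} {y} bound =
    minima-bounded⇒bounded (Realizable (y ⊝ x)) (λ c r minimal → bound c (isDist r minimal))

  split-comb : ∀ {α β} → (∀ i → β i ≤ α i) → comb C α ≡ comb C β ⊕ comb C (λ i → α i ∸ β i)
  split-comb {α} {β} β≤α = trans (ΣG-cong (λ i → cong (λ n → (+ n) · v i) (sym (ℕP.m+[n∸m]≡n (β≤α i)))))
                                 (comb-+ β (λ i → α i ∸ β i))

  split-cost : ∀ {α β} → (∀ i → β i ≤ α i) → cost C α ≡ cost C β ℕ.+ cost C (λ i → α i ∸ β i)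
  split-cost {α} {β} β≤α = trans (Σℕ-cong (λ i → cong (ℕ._* w i) (sym (ℕP.m+[n∸m]≡n (β≤α i)))))
                                 (cost-+ β (λ i → α i ∸ β i))

lemma3p1 : ∀ {m k : ℕ} (C : ChamferMask m k) (S : List (G m)) (X : G m → Set)
    (p q : G m) → p ∈ S → X p → InXbar C S X q →
    (D : ℕ) → IsDist C p q D → IsDistToXbar C S X p D →
    (α : Fin k → ℕ) → p ≡ q ⊕ comb C α → D ≡ cost C α →
    (β : Fin k → ℕ) → (∀ i → β i ≤ α i) →
    (p' : G m) → p' ≡ q ⊕ comb C β → p' ∈ S →
    IsDistToXbar C S X p' (cost C β) × IsDist C p' q (cost C β)
lemma3p1 C S X p q _ _ q∈X̄ D _ (_ , D-minimal) α p≡ D≡ β β≤α p' p'≡ _ =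
  ((q , q∈X̄ , dist-p'q) , λ y _ y∈X̄ dist → cost-β≤ y∈X̄ (proj₁ dist)) , dist-p'q
  where
  open Paths C
  open ≡-Reasoning
  δ : Fin _ → ℕ
  δ i = α i ∸ β i

  p≡p'⊕δ : p ≡ p' ⊕ comb C δ
  p≡p'⊕δ = begin
    p                                ≡⟨ p≡ ⟩
    q ⊕ comb C α                     ≡⟨ cong (q ⊕_) (split-comb β≤α) ⟩
    q ⊕ (comb C β ⊕ comb C δ)        ≡⟨ sym (AbelianGroup.assoc (⊕-abelianGroup _) q _ _) ⟩
    (q ⊕ comb C β) ⊕ comb C δ        ≡⟨ cong (_⊕ comb C δ) (sym p'≡) ⟩
    p' ⊕ comb C δ                    ∎

  p→p' : Realizable (p' ⊝ p) (cost C δ)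
  p→p' = subst (λ z → Realizable (p' ⊝ z) (cost C δ)) (sym p≡p'⊕δ) (realizable-return p' δ)

  cost-β≤ : ∀ {y c} → InXbar C S X y → Realizable (y ⊝ p') c → cost C β ≤ c
  cost-β≤ {y} {c} y∈X̄ p'→y = ℕP.+-cancelʳ-≤ (cost C δ) _ _ shifted
    where
    D≤ : D ≤ cost C δ ℕ.+ c
    D≤ = dist-bounded⇒cost-bounded (λ c' → D-minimal y c' y∈X̄) _ (realizable-trans p→p' p'→y)
    shifted : cost C β ℕ.+ cost C δ ≤ c ℕ.+ cost C δ
    shifted = subst₂ _≤_ (trans D≡ (split-cost β≤α)) (ℕP.+-comm (cost C δ) c) D≤

  dist-p'q : IsDist C p' q (cost C β)
  dist-p'q = isDist (subst (λ z → Realizable (q ⊝ z) (cost C β)) (sym p'≡) (realizable-return q β))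
                    (λ _ → cost-β≤ q∈X̄)
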